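{- Let $k\ge0$, let $X$ be a $k$-step nilspace and let $n\ge k+2$. A map $c:\{0,1\}^n\to X$ is in $C^n(X)$ if and only if, for every $(k+1)$-dimensional face $F\subseteq\{0,1\}^n$ containing some point $v$ with $v_n=0$, we have $c\circ\phi_F\in C^{k+1}(X)$.
   Context: A face of $\{0,1\}^n$ is a set obtained by fixing some coordinates; its dimension is the number of free coordinates; $\phi_F:\{0,1\}^{\dim F}\to F$ is the bijection filling the free coordinates of $F$, in increasing order, by the input coordinates. A nilspace is a set $X$ with $C^m(X)\subseteq X^{\{0,1\}^m}$ ($m\ge0$) closed under precomposition with discrete-cube morphisms (restrictions of affine homomorphisms $\mathbb{Z}^{m'}\to\mathbb{Z}^m$), with $C^1(X)=X^{\{0,1\}}$, and in which every $m$-corner (a map $c':\{0,1\}^m\setminus\{1^m\}\to X$ with $c'\circ\phi_F\in C^{m-1}(X)$ for each $(m-1)$-face $F\ni0^m$) extends to some element of $C^m(X)$; $k$-step means every $(k+1)$-corner has a unique extension. -}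

module Defs where

open import Level using (Level; _⊔_)
open import Data.Nat using (ℕ; zero; suc; _+_)
open import Data.Bool using (Bool; true; false)
open import Data.Integer using (ℤ; +_) renaming (_+_ to _+ℤ_; _*_ to _*ℤ_)
open import Data.Maybe using (Maybe; just; nothing)
open import Data.Vec using (Vec; []; _∷_; map; zipWith; replicate)
open import Data.Product using (Σ; ∃; _×_; _,_)
open import Data.Empty using (⊥)
open import Relation.Binary.PropositionalEquality using (_≡_; _≢_)
open import Relation.Nullary using (¬_)

-- Points of the discrete cube {0,1}^n  (false = 0, true = 1).
Cube : ℕ → Set
Cube n = Vec Bool n

zeros : (n : ℕ) → Cube n
zeros n = replicate n false

ones : (n : ℕ) → Cube n
ones n = replicate n true

-- Discrete-cube morphisms: restrictions of affine homomorphisms Z^{m'} → Z^m.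
b2z : Bool → ℤ
b2z false = + 0
b2z true  = + 1

dot : ∀ {m} → Vec ℤ m → Vec ℤ m → ℤ
dot []       []       = + 0
dot (a ∷ as) (b ∷ bs) = (a *ℤ b) +ℤ dot as bs

IsCubeMorphism : ∀ {m′ m} → (Cube m′ → Cube m) → Set
IsCubeMorphism {m′} {m} f =
  Σ (Vec (Vec ℤ m′) m) λ A → Σ (Vec ℤ m) λ b →
    ∀ v → map b2z (f v) ≡ zipWith _+ℤ_ b (map (λ row → dot row (map b2z v)) A)

-- Faces of {0,1}^n: nothing = free coordinate, just b = coordinate fixed to b.
Face : ℕ → Set
Face n = Vec (Maybe Bool) n

dim : ∀ {n} → Face n → ℕ
dim []            = 0
dim (nothing ∷ F) = suc (dim F)
dim (just _ ∷ F)  = dim F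

-- φ_F : {0,1}^{dim F} → F, filling the free coordinates in increasing order.
φ : ∀ {n} (F : Face n) → Cube (dim F) → Cube n
φ []            []      = []
φ (nothing ∷ F) (x ∷ w) = x ∷ φ F w
φ (just b ∷ F)  w       = b ∷ φ F w

_∈F_ : ∀ {n} → Cube n → Face n → Set
v ∈F F = ∃ λ w → φ F w ≡ v

-- The last coordinate v_n of v is 0 (false); impossible for n = 0.
LastZero : ∀ {n} → Cube n → Set
LastZero []           = ⊥
LastZero (x ∷ [])     = x ≡ false
LastZero (x ∷ y ∷ v)  = LastZero (y ∷ v)

module _ {ℓ ℓ′ : Level} {X : Set ℓ} (C : (m : ℕ) → (Cube m → X) → Set ℓ′) where

  PreCorner : ℕ → Set ℓ
  PreCorner m = (v : Cube m) → v ≢ ones m → X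

  -- c' ∘ φ_F ∈ C^{m-1}(X) for every (m-1)-face F ∋ 0^m (stated for any map
  -- agreeing with c' ∘ φ_F, which on {0,1}^m ∖ {1^m} is exactly c' ∘ φ_F).
  IsCorner : (m : ℕ) → PreCorner m → Set (ℓ ⊔ ℓ′)
  IsCorner m c′ = (F : Face m) → dim F + 1 ≡ m → zeros m ∈F F →
    (d : Cube (dim F) → X) → (∀ w (p : φ F w ≢ ones m) → d w ≡ c′ (φ F w) p) →
    C (dim F) d

  Extends : ∀ {m} → (Cube m → X) → PreCorner m → Set ℓ
  Extends {m} c c′ = ∀ v (p : v ≢ ones m) → c v ≡ c′ v p

record Nilspace (ℓ ℓ′ : Level) : Set (Level.suc (ℓ ⊔ ℓ′)) where
  field
    Carrier : Set ℓ
    C       : (m : ℕ) → (Cube m → Carrier) → Set ℓ′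
    -- cube sets are sets of maps: membership respects pointwise equality
    C-ext   : ∀ {m} {c d : Cube m → Carrier} → (∀ v → c v ≡ d v) → C m c → C m d
    C-morph : ∀ {m′ m} (f : Cube m′ → Cube m) → IsCubeMorphism f →
              ∀ c → C m c → C m′ (λ v → c (f v))
    C-1     : ∀ c → C 1 c
    corner-completion : ∀ m (c′ : PreCorner {X = Carrier} C m) → IsCorner C m c′ →
              Σ (Cube m → Carrier) λ c → C m c × Extends C c c′

-- k-step: every (k+1)-corner has a unique extension (uniqueness up to pointwise equality;
-- existence is the corner-completion axiom).
IsKStep : ∀ {ℓ ℓ′} → ℕ → Nilspace ℓ ℓ′ → Set (ℓ ⊔ ℓ′)
IsKStep k X = ∀ (c′ : PreCorner C (suc k)) → IsCorner C (suc k) c′ →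
    ∀ c d → C (suc k) c → C (suc k) d → Extends C c c′ → Extends C d c′ →
    ∀ v → c v ≡ d v
  where open Nilspace X

module Submission where

-- Write K = k+1.  Faces of cubes are cubes (faces are cube
-- morphisms), which gives the forward direction.  For the converse we use
-- indexed faces (faces carrying their dimension in the type), which compose.
--  * Completion criterion: a map e on {0,1}^(m+1) is a cube as soon as its
--    lower faces (codimension one, through 0) are cubes and every cube that
--    agrees with e off 1^(m+1) agrees with it at 1^(m+1) (corner completion).
--  * In a k-step nilspace two K-cubes agreeing off 1^K are equal, so the second
--    condition holds whenever the top face (first coordinates fixed to 1) of e
--    is a K-cube.
--  * Hence, by induction on n ≥ K, a map on {0,1}^n all of whose K-faces are
--    cubes is a cube.
--  * Under the hypothesis of the theorem every K-face is a cube: if its last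
--    coordinate is free or fixed to 0 it meets {v_n = 0}; if it is fixed to 1,
--    free the last coordinate to get a (K+1)-face whose lower faces and top face
--    meet {v_n = 0}, so it is a cube, and our face is one of its faces.

open import Defs
open import Level using (Level)
open import Data.Nat using (ℕ; zero; suc; _+_; _∸_; _≤_)
open import Data.Nat.Properties using (suc-injective; +-comm; m∸n+n≡m; ≤-trans; n≤1+n)
open import Data.Bool using (Bool; true; false) renaming (_≟_ to _≟B_)
open import Data.Integer using (ℤ; +_) renaming (_+_ to _+ℤ_; _*_ to _*ℤ_)
open import Data.Integer.Properties using () renaming (+-identityˡ to +ℤ-identityˡ; +-identityʳ to +ℤ-identityʳ)
open import Data.Vec using (Vec; []; _∷_; map; zipWith; replicate; _∷ʳ_)
open import Data.Vec.Properties using (∷-injectiveˡ; ∷-injectiveʳ; ≡-dec)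
open import Data.Maybe using (just; nothing)
open import Data.Product using (∃; _×_; _,_)
open import Relation.Nullary using (yes; no)
open import Relation.Binary.PropositionalEquality using (_≡_; _≢_; refl; sym; trans; cong; cong₂; subst; module ≡-Reasoning)
open import Relation.Binary.PropositionalEquality.Properties using (subst-subst-sym)
open import Function.Bundles using (_⇔_; mk⇔)

data IFace : ℕ → ℕ → Set where
  []   : IFace 0 0
  free : ∀ {n d} → IFace n d → IFace (suc n) (suc d)
  fix  : ∀ {n d} → Bool → IFace n d → IFace (suc n) d

iφ : ∀ {n d} → IFace n d → Cube d → Cube n
iφ []        _       = []
iφ (free G)  (x ∷ w) = x ∷ iφ G w
iφ (fix b G) w       = b ∷ iφ G w

toI : ∀ {n} (F : Face n) → IFace n (dim F)
toI []            = []
toI (nothing ∷ F) = free (toI F)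
toI (just b ∷ F)  = fix b (toI F)

φ-toI : ∀ {n} (F : Face n) w → φ F w ≡ iφ (toI F) w
φ-toI []            []      = refl
φ-toI (nothing ∷ F) (x ∷ w) = cong (x ∷_) (φ-toI F w)
φ-toI (just b ∷ F)  w       = cong (b ∷_) (φ-toI F w)

fromI : ∀ {n d} → IFace n d → Face n
fromI []        = []
fromI (free G)  = nothing ∷ fromI G
fromI (fix b G) = just b ∷ fromI G

dim-fromI : ∀ {n d} (G : IFace n d) → dim (fromI G) ≡ d
dim-fromI []        = refl
dim-fromI (free G)  = cong suc (dim-fromI G)
dim-fromI (fix b G) = dim-fromI G

subst-∷ : ∀ {a d} (eq : a ≡ d) (x : Bool) (w : Cube a) →
  subst Cube (cong suc eq) (x ∷ w) ≡ x ∷ subst Cube eq w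
subst-∷ refl x w = refl

φ-fromI : ∀ {n d} (G : IFace n d) w → φ (fromI G) w ≡ iφ G (subst Cube (dim-fromI G) w)
φ-fromI []        []      = refl
φ-fromI (free G)  (x ∷ w) =
  trans (cong (x ∷_) (φ-fromI G w)) (cong (iφ (free G)) (sym (subst-∷ (dim-fromI G) x w)))
φ-fromI (fix b G) w       = cong (b ∷_) (φ-fromI G w)

allFree : ∀ d → IFace d d
allFree zero    = []
allFree (suc d) = free (allFree d)

iφ-allFree : ∀ {d} (w : Cube d) → iφ (allFree d) w ≡ w
iφ-allFree []      = refl
iφ-allFree (x ∷ w) = cong (x ∷_) (iφ-allFree w)

compose : ∀ {n d e} → IFace n d → IFace d e → IFace n e
compose []        []        = []
compose (free F)  (free G)  = free (compose F G)
compose (free F)  (fix b G) = fix b (compose F G)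
compose (fix b F) G         = fix b (compose F G)

iφ-compose : ∀ {n d e} (F : IFace n d) (G : IFace d e) w → iφ (compose F G) w ≡ iφ F (iφ G w)
iφ-compose []        []        w       = refl
iφ-compose (free F)  (free G)  (x ∷ w) = cong (x ∷_) (iφ-compose F G w)
iφ-compose (free F)  (fix b G) w       = cong (b ∷_) (iφ-compose F G w)
iφ-compose (fix b F) G         w       = cong (b ∷_) (iφ-compose F G w)

topFace : ∀ j d → IFace (j + d) d
topFace zero    d = allFree d
topFace (suc j) d = fix true (topFace j d)

iφ-topFace-ones : ∀ j d → iφ (topFace j d) (ones d) ≡ ones (j + d)
iφ-topFace-ones zero    d = iφ-allFree (ones d)
iφ-topFace-ones (suc j) d = cong (true ∷_) (iφ-topFace-ones j d)

iφ-topFace-≢ones : ∀ j d w → w ≢ ones d → iφ (topFace j d) w ≢ ones (j + d)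
iφ-topFace-≢ones zero    d w w≢1 p = w≢1 (trans (sym (iφ-allFree w)) p)
iφ-topFace-≢ones (suc j) d w w≢1 p = iφ-topFace-≢ones j d w w≢1 (∷-injectiveʳ p)

_▷fix_ : ∀ {n d} → IFace n d → Bool → IFace (suc n) d
[]       ▷fix b = fix b []
free G   ▷fix b = free (G ▷fix b)
fix b′ G ▷fix b = fix b′ (G ▷fix b)

_▷free : ∀ {n d} → IFace n d → IFace (suc n) (suc d)
[]      ▷free = free []
free G  ▷free = free (G ▷free)
fix b G ▷free = fix b (G ▷free)

iφ-▷fix : ∀ {n d} (G : IFace n d) b w → iφ (G ▷fix b) w ≡ iφ G w ∷ʳ b
iφ-▷fix []         b []      = refl
iφ-▷fix (free G)   b (x ∷ w) = cong (x ∷_) (iφ-▷fix G b w)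
iφ-▷fix (fix b′ G) b w       = cong (b′ ∷_) (iφ-▷fix G b w)

iφ-▷free : ∀ {n d} (G : IFace n d) (w : Cube d) x → iφ (G ▷free) (w ∷ʳ x) ≡ iφ G w ∷ʳ x
iφ-▷free []        []      x = refl
iφ-▷free (free G)  (y ∷ w) x = cong (y ∷_) (iφ-▷free G w x)
iφ-▷free (fix b G) w       x = cong (b ∷_) (iφ-▷free G w x)

data LastView : ∀ {n d} → IFace (suc n) d → Set where
  lastFixed : ∀ {n d} b (G : IFace n d) → LastView (G ▷fix b)
  lastFree  : ∀ {n d} (G : IFace n d) → LastView (G ▷free)

lastView : ∀ {n d} (G : IFace (suc n) d) → LastView G
lastView (free {zero} []) = lastFree []
lastView (fix b [])       = lastFixed b []
lastView (free {suc n} G) with lastView G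
... | lastFixed b G₀ = lastFixed b (free G₀)
... | lastFree G₀    = lastFree (free G₀)
lastView (fix {suc n} b G) with lastView G
... | lastFixed b′ G₀ = lastFixed b′ (fix b G₀)
... | lastFree G₀     = lastFree (fix b G₀)

-- The parametrisation of a face is the restriction of an affine map Z^d → Z^n:
-- a free coordinate contributes a unit row and offset 0, a coordinate fixed to
-- b a zero row and offset b.
zeroRow : ∀ d → Vec ℤ d
zeroRow d = replicate d (+ 0)

faceMatrix : ∀ {n d} → IFace n d → Vec (Vec ℤ d) n
faceMatrix []        = []
faceMatrix (free G)  = (+ 1 ∷ zeroRow _) ∷ map (+ 0 ∷_) (faceMatrix G)
faceMatrix (fix b G) = zeroRow _ ∷ faceMatrix G

faceOffset : ∀ {n d} → IFace n d → Vec ℤ n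
faceOffset []        = []
faceOffset (free G)  = + 0 ∷ faceOffset G
faceOffset (fix b G) = b2z b ∷ faceOffset G

dot-zeroRow : ∀ {d} (ys : Vec ℤ d) → dot (zeroRow d) ys ≡ + 0
dot-zeroRow []       = refl
dot-zeroRow (y ∷ ys) = trans (+ℤ-identityˡ _) (dot-zeroRow ys)

dot-shift : ∀ {m d} (A : Vec (Vec ℤ d) m) y ys →
  map (λ row → dot row (y ∷ ys)) (map (+ 0 ∷_) A) ≡ map (λ row → dot row ys) A
dot-shift []      y ys = refl
dot-shift (r ∷ A) y ys = cong₂ _∷_ (+ℤ-identityˡ _) (dot-shift A y ys)

unitRow : ∀ x → + 0 +ℤ (+ 1 *ℤ b2z x +ℤ + 0) ≡ b2z x
unitRow true  = refl
unitRow false = refl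

iφ-affine : ∀ {n d} (G : IFace n d) (w : Cube d) → map b2z (iφ G w) ≡
  zipWith _+ℤ_ (faceOffset G) (map (λ row → dot row (map b2z w)) (faceMatrix G))
iφ-affine []        []      = refl
iφ-affine (free G)  (x ∷ w) = cong₂ _∷_ freeCoordinate
  (trans (iφ-affine G w)
         (cong (zipWith _+ℤ_ (faceOffset G)) (sym (dot-shift (faceMatrix G) (b2z x) (map b2z w)))))
  where
  freeCoordinate : b2z x ≡ + 0 +ℤ (+ 1 *ℤ b2z x +ℤ dot (zeroRow _) (map b2z w))
  freeCoordinate = trans (sym (unitRow x))
    (cong (λ z → + 0 +ℤ (+ 1 *ℤ b2z x +ℤ z)) (sym (dot-zeroRow (map b2z w))))
iφ-affine (fix b G) w       = cong₂ _∷_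
  (sym (trans (cong (b2z b +ℤ_) (dot-zeroRow (map b2z w))) (+ℤ-identityʳ _)))
  (iφ-affine G w)

iφ-isCubeMorphism : ∀ {n d} (G : IFace n d) → IsCubeMorphism (iφ G)
iφ-isCubeMorphism G = faceMatrix G , faceOffset G , iφ-affine G

lowerFace-≢ones : ∀ {m} (F : Face m) → dim F + 1 ≡ m → zeros m ∈F F → ∀ w → φ F w ≢ ones m
lowerFace-≢ones []            ()  _            _       _
lowerFace-≢ones (nothing ∷ F) eq  (x ∷ w₀ , e) (y ∷ w) p =
  lowerFace-≢ones F (suc-injective eq) (w₀ , ∷-injectiveʳ e) w (∷-injectiveʳ p)
lowerFace-≢ones (just b ∷ F)  eq  (w₀ , e)     w       p
  with trans (sym (∷-injectiveˡ e)) (∷-injectiveˡ p)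
... | ()

lowerFace-dim : ∀ {a m} → a + 1 ≡ suc m → a ≡ m
lowerFace-dim {a} eq = suc-injective (trans (+-comm 1 a) eq)

lastZero-∷ʳ : ∀ {n} (v : Cube n) → LastZero (v ∷ʳ false)
lastZero-∷ʳ []          = refl
lastZero-∷ʳ (x ∷ [])    = refl
lastZero-∷ʳ (x ∷ y ∷ v) = lastZero-∷ʳ (y ∷ v)

zeros-∷ʳ : ∀ n → zeros (suc n) ≡ zeros n ∷ʳ false
zeros-∷ʳ zero    = refl
zeros-∷ʳ (suc n) = cong (false ∷_) (zeros-∷ʳ n)

lastZero-▷free : ∀ {n d} (G : IFace n d) (w : Cube d) → LastZero (iφ (G ▷free) (w ∷ʳ false))
lastZero-▷free G w = subst LastZero (sym (iφ-▷free G w false)) (lastZero-∷ʳ (iφ G w))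

module CubeFacts {ℓ ℓ′ : Level} (X : Nilspace ℓ ℓ′) where
  open Nilspace X renaming (Carrier to A)

  restrict : ∀ {n d} {c : Cube n → A} → C n c → (G : IFace n d) → C d (λ w → c (iφ G w))
  restrict {c = c} h G = C-morph (iφ G) (iφ-isCubeMorphism G) c h

  restrictFace : ∀ {n} {c : Cube n → A} → C n c → (F : Face n) → C (dim F) (λ w → c (φ F w))
  restrictFace {c = c} h F = C-ext (λ w → cong c (sym (φ-toI F w))) (restrict h (toI F))

  transport : ∀ {a d} (eq : a ≡ d) (f : Cube a → A) (g : Cube d → A) →
    (∀ w → f w ≡ g (subst Cube eq w)) → C a f → C d g
  transport refl f g f≗g h = C-ext f≗g h

  LowerFacesAreCubes : ∀ {m} → (Cube m → A) → Set ℓ′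
  LowerFacesAreCubes {m} e =
    (F : Face m) → dim F + 1 ≡ m → zeros m ∈F F → C (dim F) (λ w → e (φ F w))

  -- Completion criterion: if the lower faces of e are cubes, e without its top
  -- vertex is a corner; if moreover every cube agreeing with e off the top vertex
  -- agrees with e there, then the completion of this corner is e, so e is a cube.
  cubeByCompletion : ∀ {m} (e : Cube m → A) → LowerFacesAreCubes e →
    ((c̃ : Cube m → A) → C m c̃ → (∀ v → v ≢ ones m → c̃ v ≡ e v) → c̃ (ones m) ≡ e (ones m)) →
    C m e
  cubeByCompletion {m} e lower top with corner-completion m (λ v _ → e v) isCorner
    where
    isCorner : IsCorner C m (λ v _ → e v)
    isCorner F eq z d agree = C-ext (λ w → sym (agree w (lowerFace-≢ones F eq z w))) (lower F eq z)
  ... | c̃ , c̃-cube , c̃-extends = C-ext c̃≗e c̃-cube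
    where
    c̃≗e : ∀ v → c̃ v ≡ e v
    c̃≗e v with ≡-dec _≟B_ v (ones m)
    ... | yes refl = top c̃ c̃-cube c̃-extends
    ... | no v≢1   = c̃-extends v v≢1

module KStepFacts {ℓ ℓ′ : Level} (X : Nilspace ℓ ℓ′) (k : ℕ) (kStep : IsKStep k X) where
  open Nilspace X renaming (Carrier to A)
  open CubeFacts X

  K : ℕ
  K = suc k

  -- Two K-cubes agreeing off 1^K agree everywhere: both complete the same corner.
  K-cube-unique : (a b : Cube K → A) → C K a → C K b →
    (∀ w → w ≢ ones K → a w ≡ b w) → ∀ w → a w ≡ b w
  K-cube-unique a b a-cube b-cube a≗b = kStep (λ w _ → a w) isCorner a b a-cube b-cube
    (λ _ _ → refl) (λ w w≢1 → sym (a≗b w w≢1))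
    where
    isCorner : IsCorner C K (λ w _ → a w)
    isCorner F eq z d agree =
      C-ext (λ w → sym (agree w (lowerFace-≢ones F eq z w))) (restrictFace a-cube F)

  -- A map on {0,1}^(j+1+K) whose lower faces and whose top face are cubes is a
  -- cube: a cube agreeing with it off the top vertex has, by uniqueness, the same
  -- restriction to the top face, which contains the top vertex.
  cubeFromLowerAndTop : ∀ j (e : Cube (suc j + K) → A) → LowerFacesAreCubes e →
    C K (λ w → e (iφ (topFace (suc j) K) w)) → C (suc j + K) e
  cubeFromLowerAndTop j e lower top-cube = cubeByCompletion e lower agreeAtTop
    where
    T : IFace (suc j + K) K
    T = topFace (suc j) K

    agreeAtTop : (c̃ : Cube (suc j + K) → A) → C (suc j + K) c̃ →
      (∀ v → v ≢ ones (suc j + K) → c̃ v ≡ e v) → c̃ (ones (suc j + K)) ≡ e (ones (suc j + K))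
    agreeAtTop c̃ c̃-cube c̃≗e = begin
      c̃ (ones (suc j + K))       ≡⟨ cong c̃ (sym (iφ-topFace-ones (suc j) K)) ⟩
      c̃ (iφ T (ones K))          ≡⟨ K-cube-unique (λ w → c̃ (iφ T w)) (λ w → e (iφ T w))
                                      (restrict c̃-cube T) top-cube
                                      (λ w w≢1 → c̃≗e (iφ T w) (iφ-topFace-≢ones (suc j) K w w≢1))
                                      (ones K) ⟩
      e (iφ T (ones K))          ≡⟨ cong e (iφ-topFace-ones (suc j) K) ⟩
      e (ones (suc j + K))       ∎
      where open ≡-Reasoning

  -- A map on {0,1}^n, n ≥ K, all of whose K-dimensional faces are cubes is a cube
  -- (induction on n - K: lower faces by induction, the top face by hypothesis).
  cubeFromKFaces : ∀ j {n} → n ≡ j + K → (c : Cube n → A) →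
    ((G : IFace n K) → C K (λ w → c (iφ G w))) → C n c
  cubeFromKFaces zero    refl c KFaces =
    C-ext (λ w → cong c (iφ-allFree w)) (KFaces (allFree K))
  cubeFromKFaces (suc j) refl c KFaces =
    cubeFromLowerAndTop j c lower (KFaces (topFace (suc j) K))
    where
    lower : LowerFacesAreCubes c
    lower F eq _ = cubeFromKFaces j (lowerFace-dim eq) (λ w → c (φ F w)) λ G →
      C-ext (λ w → cong c (trans (iφ-compose (toI F) G w) (sym (φ-toI F (iφ G w)))))
            (KFaces (compose (toI F) G))

  LastZeroFacesAreCubes : ∀ {n} → (Cube n → A) → Set ℓ′
  LastZeroFacesAreCubes {n} c = (F : Face n) → dim F ≡ K →
    (∃ λ v → v ∈F F × LastZero v) → C (dim F) (λ w → c (φ F w))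

  lastZeroFace : ∀ {n d} (c : Cube n → A) → LastZeroFacesAreCubes c →
    (G : IFace n d) → d ≡ K → (w : Cube d) → LastZero (iφ G w) → C d (λ w → c (iφ G w))
  lastZeroFace c hyp G d≡K w lastZero =
    transport eq (λ u → c (φ F u)) (λ u → c (iφ G u)) (λ u → cong c (φ-fromI G u))
      (hyp F (trans eq d≡K) (iφ G w , (subst Cube (sym eq) w , onF) , lastZero))
    where
    F   = fromI G
    eq  = dim-fromI G
    onF : φ F (subst Cube (sym eq) w) ≡ iφ G w
    onF = trans (φ-fromI G _) (cong (iφ G) (subst-subst-sym eq))

  -- A K-face with last coordinate fixed to 1 is a face of the (K+1)-face obtained
  -- by freeing that coordinate; the latter is a cube since its lower faces (through
  -- the image of 0) and its top face (through the image of (1,0,…,0)) meet {v_n = 0}.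
  lastOneFace : ∀ {n} (c : Cube (suc n) → A) → LastZeroFacesAreCubes c →
    (G : IFace n K) → C K (λ w → c (iφ (G ▷fix true) w))
  lastOneFace c hyp G = C-ext onLastOne (restrict e-cube (allFree K ▷fix true))
    where
    G⁺ = G ▷free

    e : Cube (suc K) → A
    e w = c (iφ G⁺ w)

    lower : LowerFacesAreCubes e
    lower F eq (w₀ , φw₀≡0) =
      C-ext (λ w → cong c (trans (iφ-compose G⁺ (toI F) w) (cong (iφ G⁺) (sym (φ-toI F w)))))
        (lastZeroFace c hyp (compose G⁺ (toI F)) (lowerFace-dim eq) w₀
          (subst LastZero (sym throughZero) (lastZero-▷free G (zeros K))))
      where
      throughZero : iφ (compose G⁺ (toI F)) w₀ ≡ iφ G⁺ (zeros K ∷ʳ false)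
      throughZero = trans (iφ-compose G⁺ (toI F) w₀)
        (cong (iφ G⁺) (trans (sym (φ-toI F w₀)) (trans φw₀≡0 (zeros-∷ʳ K))))

    T : IFace (suc K) K
    T = topFace 1 K

    top : C K (λ w → e (iφ T w))
    top = C-ext (λ w → cong c (iφ-compose G⁺ T w))
      (lastZeroFace c hyp (compose G⁺ T) refl (zeros K)
        (subst LastZero (sym throughOneZero) (lastZero-▷free G (true ∷ zeros k))))
      where
      throughOneZero : iφ (compose G⁺ T) (zeros K) ≡ iφ G⁺ ((true ∷ zeros k) ∷ʳ false)
      throughOneZero = trans (iφ-compose G⁺ T (zeros K))
        (cong (λ u → iφ G⁺ (true ∷ u)) (trans (iφ-allFree (zeros K)) (zeros-∷ʳ k)))

    e-cube : C (suc K) e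
    e-cube = cubeFromLowerAndTop 0 e lower top

    onLastOne : ∀ w → e (iφ (allFree K ▷fix true) w) ≡ c (iφ (G ▷fix true) w)
    onLastOne w = cong c (begin
      iφ G⁺ (iφ (allFree K ▷fix true) w) ≡⟨ cong (iφ G⁺) (iφ-▷fix (allFree K) true w) ⟩
      iφ G⁺ (iφ (allFree K) w ∷ʳ true)   ≡⟨ cong (λ u → iφ G⁺ (u ∷ʳ true)) (iφ-allFree w) ⟩
      iφ G⁺ (w ∷ʳ true)                  ≡⟨ iφ-▷free G w true ⟩
      iφ G w ∷ʳ true                     ≡⟨ sym (iφ-▷fix G true w) ⟩
      iφ (G ▷fix true) w                 ∎)
      where open ≡-Reasoning

  -- Under the hypothesis every K-face is a cube, by the position of its last coordinate.
  allKFaces : ∀ {n} (c : Cube (suc n) → A) → LastZeroFacesAreCubes c →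
    (G : IFace (suc n) K) → C K (λ w → c (iφ G w))
  allKFaces c hyp G with lastView G
  ... | lastFixed false G₀ = lastZeroFace c hyp (G₀ ▷fix false) refl (zeros K)
    (subst LastZero (sym (iφ-▷fix G₀ false (zeros K))) (lastZero-∷ʳ (iφ G₀ (zeros K))))
  ... | lastFree G₀        = lastZeroFace c hyp (G₀ ▷free) refl (zeros k ∷ʳ false)
    (lastZero-▷free G₀ (zeros k))
  ... | lastFixed true G₀  = lastOneFace c hyp G₀

  cubeFromLastZeroFaces : ∀ n → K ≤ n → (c : Cube n → A) → LastZeroFacesAreCubes c → C n c
  cubeFromLastZeroFaces (suc n) K≤n c hyp =
    cubeFromKFaces (suc n ∸ K) (sym (m∸n+n≡m K≤n)) c (allKFaces c hyp)

lemma3p2p13 : ∀ {ℓ ℓ′ : Level} (k : ℕ) (X : Nilspace ℓ ℓ′) → IsKStep k X →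
    (n : ℕ) → k + 2 ≤ n → (c : Cube n → Nilspace.Carrier X) →
    Nilspace.C X n c ⇔
    ((F : Face n) → dim F ≡ suc k → (∃ λ v → v ∈F F × LastZero v) →
    Nilspace.C X (dim F) (λ w → c (φ F w)))
lemma3p2p13 k X kStep n k+2≤n c =
  mk⇔ (λ c-cube F _ _ → restrictFace c-cube F) (cubeFromLastZeroFaces n k+1≤n c)
  where
  open CubeFacts X
  open KStepFacts X k kStep
  k+1≤n : suc k ≤ n
  k+1≤n = ≤-trans (n≤1+n (suc k)) (subst (_≤ n) (+-comm k 2) k+2≤n)
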